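{- Let $R$ be a commutative ring with unity, $A$ an $R$-algebra, $n\ge1$, and ${\bf A}=(a_{ij})\in \mathrm{Mat}(n,A)$. Then in $\mathrm{Mat}(n,A)[[t]]$, \[ {\bf I}_n-{\bf A}t=\prod^{<}_{\substack{(i_1,j_1)\cdots(i_r,j_r)\in L_{[n]\times[n]}\\ j_k=i_{k+1}\ (k=1,\dots,r-1)}}\bigl({\bf I}_n-a_{i_1i_2}a_{i_2i_3}\cdots a_{i_{r-1}i_r}a_{i_rj_r}{\bf E}_{i_1j_r}t^{r}\bigr), \] where the product runs over Lyndon words $(i_1,j_1)(i_2,j_2)\cdots(i_r,j_r)$ on the alphabet $[n]\times[n]$ satisfying $j_k=i_{k+1}$ for $k=1,\dots,r-1$, with factors multiplied in increasing lexicographic order.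
   Context: $[n]=\{1,\dots,n\}$ with its natural order; $[n]\times[n]$ carries the lexicographic order induced from $[n]$, and words over the alphabet $[n]\times[n]$ are ordered lexicographically. A nonempty word is a Lyndon word if it is not a power $w'^r$ ($r\ge2$) of another word and it is strictly smallest among its cyclic rearrangements; $L_{[n]\times[n]}$ denotes the set of Lyndon words over $[n]\times[n]$. ${\bf E}_{ij}$ is the $(i,j)$ matrix unit. $t$ is a central indeterminate and $\mathrm{Mat}(n,A)[[t]]$ is the ring of formal power series with the $t$-adic topology; the infinite product is a limit in this topology. -}

module Defs where

open import Level using (Level; _⊔_)
open import Algebra.Bundles using (Ring)
open import Data.Bool using (Bool; true; false; if_then_else_; _∧_)
open import Data.Nat as ℕ using (ℕ; zero; suc; _≤_; _<_; _∸_)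
open import Data.Fin as Fin using (Fin; zero; suc; toℕ)
open import Data.Product using (_×_; _,_; proj₁; proj₂; Σ)
open import Data.List using (List; []; _∷_; length; drop; take; _++_; foldr; concat; replicate)
open import Data.List.Relation.Unary.Linked using (Linked)
open import Relation.Binary.PropositionalEquality using (_≡_; _≢_)
open import Relation.Nullary using (¬_; does)
import Data.Product.Relation.Binary.Lex.Strict as ProdLex
import Data.List.Relation.Binary.Lex.Strict as ListLex

-- Words over the alphabet [n] × [n]  (here [n] is Fin n, natural order)

Letter : ℕ → Set
Letter n = Fin n × Fin n

Word : ℕ → Set
Word n = List (Letter n)

_<L_ : ∀ {n} → Letter n → Letter n → Set
_<L_ = ProdLex.×-Lex _≡_ Fin._<_ Fin._<_

-- lexicographic order on words (a proper prefix is smaller)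
_<W_ : ∀ {n} → Word n → Word n → Set
_<W_ = ListLex.Lex-< _≡_ _<L_

rotate : ∀ {n} → ℕ → Word n → Word n
rotate k w = drop k w ++ take k w

IsPower : ∀ {n} → Word n → Set
IsPower {n} w = Σ (Word n) λ v → Σ ℕ λ r → (2 ≤ r) × (w ≡ concat (replicate r v))

IsLyndon : ∀ {n} → Word n → Set
IsLyndon w =
  (w ≢ []) × (¬ IsPower w) ×
  (∀ k → 1 ≤ k → k < length w → rotate k w ≢ w → w <W rotate k w)

IsChain : ∀ {n} → Word n → Set
IsChain = Linked (λ x y → proj₂ x ≡ proj₁ y)

module MatSeries {c ℓ : Level} (A : Ring c ℓ) where
  open Ring A using (Carrier; _≈_; _+_; _*_; -_; 0#; 1#)

  Mat : ℕ → Set c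
  Mat n = Fin n → Fin n → Carrier

  sumFin : ∀ m → (Fin m → Carrier) → Carrier
  sumFin zero    f = 0#
  sumFin (suc m) f = f zero + sumFin m (λ k → f (suc k))

  𝐈 : ∀ {n} → Mat n
  𝐈 i j = if does (i Fin.≟ j) then 1# else 0#

  𝟎 : ∀ {n} → Mat n
  𝟎 i j = 0#

  𝐄 : ∀ {n} → Fin n → Fin n → Mat n
  𝐄 p q i j = if does (i Fin.≟ p) ∧ does (j Fin.≟ q) then 1# else 0#

  _·M_ : ∀ {n} → Carrier → Mat n → Mat n
  (x ·M M) i j = x * M i j

  -M_ : ∀ {n} → Mat n → Mat n
  (-M M) i j = - M i j

  _*M_ : ∀ {n} → Mat n → Mat n → Mat n
  _*M_ {n} M N i j = sumFin n (λ l → M i l * N l j)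

  -- Mat(n,A)[[t]] : coefficient sequences
  Series : ℕ → Set c
  Series n = ℕ → Mat n

  oneS : ∀ {n} → Series n
  oneS zero    = 𝐈
  oneS (suc m) = 𝟎

  -- Cauchy product (t central)
  _*S_ : ∀ {n} → Series n → Series n → Series n
  (f *S g) m i j = sumFin (suc m) (λ k → (f (toℕ k) *M g (m ∸ toℕ k)) i j)

  -- I_n - M t^r  (for r ≥ 1)
  I-MtPow : ∀ {n} → Mat n → ℕ → Series n
  I-MtPow M r zero    = 𝐈
  I-MtPow M r (suc m) = if does (suc m ℕ.≟ r) then -M M else 𝟎

  I-At : ∀ {n} → Mat n → Series n
  I-At 𝐀 = I-MtPow 𝐀 1

  module _ {n : ℕ} (a : Mat n) where

    chainCoef : Letter n → Word n → Carrier
    chainCoef (i , j) []              = a i j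
    chainCoef (i , j) ((i' , j') ∷ w) = a i i' * chainCoef (i' , j') w

    lastSnd : Letter n → Word n → Fin n
    lastSnd (i , j) []       = j
    lastSnd _       (y ∷ w)  = lastSnd y w

    factor : Word n → Series n
    factor []      = oneS
    factor (x ∷ w) =
      I-MtPow (chainCoef x w ·M 𝐄 (proj₁ x) (lastSnd x w)) (length (x ∷ w))

    orderedProd : List (Word n) → Series n
    orderedProd = foldr (λ w acc → factor w *S acc) oneS

  _≈[_]_ : ∀ {n} → Series n → ℕ → Series n → Set ℓ
  f ≈[ m ] g = ∀ i j → f m i j ≈ g m i j

module Submission where

-- The proof first establishes the identity in the free algebra on the
-- letters [n] × [n] and then evaluates it at the matrix A.
--  * Words and Lyndon words: lexicographic order (from the library), the
--    characterization "smaller than every proper suffix", and the standard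
--    factorization w = u v (v the smallest proper suffix).
--  * A sign-reversing involution ι on increasing sequences of Lyndon words
--    with fixed concatenation (split the first factor, or merge the first
--    two).  Since ι preserves chains and lengths, the coefficient of a chain
--    word u with 2 ≤ |u| ≤ N in the product of the factors (1 - w) vanishes;
--    so on chain words this product agrees with 1 - Σ letters.
--  * Evaluation sends the letter (i , k) to a_{ik} E_{ik} t; it only sees
--    chain words, turns the free product into the ordered matrix product,
--    and turns 1 - Σ letters into I - A t.

open import Defs
open import Algebra.Bundles using (Ring)
open import Data.Bool using (Bool; true; false; if_then_else_)
open import Data.Empty using (⊥-elim)
open import Data.Fin as Fin using (Fin; toℕ)
import Data.Fin.Properties as FinP
open import Data.List using (List; []; _∷_; _++_; length; concat; replicate; take; drop; map)
open import Data.List.Properties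
  using (++-assoc; ++-identityʳ; ++-cancelʳ; ++-conicalˡ; ++-conicalʳ; ∷-injective; ∷-injectiveʳ;
         length-++; length-++-≤ˡ; length-++-≤ʳ; length-drop; length-take; take++drop≡id)
open import Data.List.Membership.Propositional using (_∈_; _∉_)
open import Data.List.Membership.Propositional.Properties using (∈-++⁻; ∈-++⁺ˡ; ∈-++⁺ʳ; ∈-map⁻; ∈-map⁺; ∈-∃++)
open import Data.List.Relation.Binary.Lex.Core using (base; halt; this; next)
import Data.List.Relation.Binary.Lex.Strict as ListLex
open import Data.List.Relation.Binary.Permutation.Propositional using (↭-sym; ↭⇒↭ₛ)
open import Data.List.Relation.Binary.Permutation.Propositional.Properties using (shift; ∈-resp-↭)
import Data.List.Relation.Binary.Permutation.Setoid.Properties as PermS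
open import Data.List.Relation.Binary.Pointwise using (Pointwise-≡⇒≡; ≡⇒Pointwise-≡)
open import Data.List.Relation.Unary.All as All using (All; []; _∷_)
import Data.List.Relation.Unary.AllPairs as AllPairs
open import Data.List.Relation.Unary.Any using (here; there)
open import Data.List.Relation.Unary.Linked as Linked using (Linked; []; [-]; _∷_)
open import Data.List.Relation.Unary.Linked.Properties using (Linked⇒All)
open import Data.List.Relation.Unary.Unique.Propositional using (Unique)
import Data.List.Relation.Unary.Unique.Propositional.Properties as Unique
open import Data.List.Relation.Unary.Unique.Propositional.Properties using (Unique[x∷xs]⇒x∉xs)
open import Data.Maybe using (Maybe; just; nothing; maybe′)
open import Data.Nat as ℕ using (ℕ; zero; suc; _≤_; _<_; _∸_; z≤n; s≤s)
import Data.Nat.Properties as ℕP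
open import Data.Product using (Σ; _×_; _,_; proj₁; proj₂; map₁)
open import Data.Product.Properties using (≡-dec)
open import Data.Product.Relation.Binary.Pointwise.NonDependent using (≡×≡⇒≡; ≡⇒≡×≡)
import Data.Product.Relation.Binary.Lex.Strict as ProdLex
open import Data.Sum using (_⊎_; inj₁; inj₂)
open import Data.Unit using (⊤; tt)
open import Relation.Binary.Consequences using (tri⇒dec<)
open import Relation.Binary.Definitions using (Tri; tri<; tri≈; tri>; DecidableEquality; Decidable)
open import Relation.Binary.PropositionalEquality
  using (_≡_; _≢_; refl; sym; trans; cong; cong₂; subst; resp₂; isEquivalence)
  renaming (setoid to ≡-setoid)
open import Relation.Nullary using (¬_; Dec; yes; no; does)
open import Relation.Nullary.Decidable using (_×-dec_; dec-true; dec-false)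

private variable n : ℕ

tri-≡ : ∀ {a b b′ c} {A : Set a} {B : Set b} {B′ : Set b′} {C : Set c} →
        (B → B′) → (B′ → B) → Tri A B C → Tri A B′ C
tri-≡ to from (tri< a ¬b ¬c) = tri< a (λ b → ¬b (from b)) ¬c
tri-≡ to from (tri≈ ¬a b ¬c) = tri≈ ¬a (to b) ¬c
tri-≡ to from (tri> ¬a ¬b c) = tri> ¬a (λ b → ¬b (from b)) c

<L-irrefl : {a : Letter n} → ¬ (a <L a)
<L-irrefl = ProdLex.×-irreflexive {_≈₁_ = _≡_} {Fin._<_} {_≡_} {Fin._<_}
              FinP.<-irrefl FinP.<-irrefl (refl , refl)

<L-trans : {a b c : Letter n} → a <L b → b <L c → a <L c
<L-trans = ProdLex.×-transitive {_<₂_ = Fin._<_} isEquivalence (resp₂ Fin._<_) FinP.<-trans FinP.<-trans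

<L-cmp : (a b : Letter n) → Tri (a <L b) (a ≡ b) (b <L a)
<L-cmp a b = tri-≡ ≡×≡⇒≡ ≡⇒≡×≡ (ProdLex.×-compare sym FinP.<-cmp FinP.<-cmp a b)

_≟L_ : DecidableEquality (Letter n)
_≟L_ = ≡-dec FinP._≟_ FinP._≟_

<W-irrefl : {a : Word n} → ¬ (a <W a)
<W-irrefl = ListLex.<-irreflexive (λ { refl → <L-irrefl }) (≡⇒Pointwise-≡ refl)

<W-trans : {a b c : Word n} → a <W b → b <W c → a <W c
<W-trans = ListLex.<-transitive isEquivalence (resp₂ _<L_) <L-trans

<W-asym : {a b : Word n} → a <W b → ¬ (b <W a)
<W-asym p q = <W-irrefl (<W-trans p q)

<W-cmp : (a b : Word n) → Tri (a <W b) (a ≡ b) (b <W a)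
<W-cmp a b = tri-≡ Pointwise-≡⇒≡ ≡⇒Pointwise-≡ (ListLex.<-compare sym <L-cmp a b)

_<W?_ : Decidable (_<W_ {n})
_<W?_ = tri⇒dec< <W-cmp

infix 4 _≤W_
_≤W_ : Word n → Word n → Set
a ≤W b = a ≡ b ⊎ a <W b

≤W-trans : {a b c : Word n} → a ≤W b → b ≤W c → a ≤W c
≤W-trans (inj₁ refl) q           = q
≤W-trans (inj₂ p)    (inj₁ refl) = inj₂ p
≤W-trans (inj₂ p)    (inj₂ q)    = inj₂ (<W-trans p q)

<≤W-trans : {a b c : Word n} → a <W b → b ≤W c → a <W c
<≤W-trans p (inj₁ refl) = p
<≤W-trans p (inj₂ q)    = <W-trans p q

≮W⇒≥ : {a b : Word n} → ¬ (a <W b) → b ≤W a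
≮W⇒≥ {a = a} {b} a≮b with <W-cmp a b
... | tri< a<b _ _ = ⊥-elim (a≮b a<b)
... | tri≈ _ refl _ = inj₁ refl
... | tri> _ _ b<a = inj₂ b<a

prefix< : (a : Word n) {t : Word n} → t ≢ [] → a <W (a ++ t)
prefix< []      {[]}    t≢[] = ⊥-elim (t≢[] refl)
prefix< []      {_ ∷ _} _    = halt
prefix< (x ∷ a) t≢[]         = next refl (prefix< a t≢[])

++-monoˡ-<W : (p : Word n) {a b : Word n} → a <W b → (p ++ a) <W (p ++ b)
++-monoˡ-<W []      a<b = a<b
++-monoˡ-<W (x ∷ p) a<b = next refl (++-monoˡ-<W p a<b)

++-cancelˡ-<W : (p : Word n) {a b : Word n} → (p ++ a) <W (p ++ b) → a <W b
++-cancelˡ-<W []      q          = q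
++-cancelˡ-<W (x ∷ p) (this x<x) = ⊥-elim (<L-irrefl x<x)
++-cancelˡ-<W (x ∷ p) (next _ q) = ++-cancelˡ-<W p q

-- a < b is strong when it is decided at a letter, so that it survives any
-- continuation of the two words.
Strong : Word n → Word n → Set
Strong a b = ∀ x y → (a ++ x) <W (b ++ y)

prefix-or-strong : {a b : Word n} → a <W b →
                   (Σ (Word n) λ t → t ≢ [] × b ≡ a ++ t) ⊎ Strong a b
prefix-or-strong (base ())
prefix-or-strong halt         = inj₁ (_ , (λ ()) , refl)
prefix-or-strong (this x<y)   = inj₂ λ _ _ → this x<y
prefix-or-strong (next refl p) with prefix-or-strong p
... | inj₁ (t , t≢[] , refl) = inj₁ (t , t≢[] , refl)
... | inj₂ strong            = inj₂ λ x y → next refl (strong x y)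

short-strong : {a b : Word n} → a <W b → length b ≤ length a → Strong a b
short-strong a<b |b|≤|a| with prefix-or-strong a<b
... | inj₂ strong = strong
short-strong {a = a} _ |b|≤|a| | inj₁ (x ∷ t , _ , refl) =
  ⊥-elim (ℕP.m+1+n≰m (length a) (subst (_≤ length a) (length-++ a) |b|≤|a|))
short-strong _ _ | inj₁ ([] , []≢[] , _) = ⊥-elim ([]≢[] refl)

equal-length-prefix : (a b c d : Word n) → length a ≡ length b →
                      (a ++ c) <W (b ++ d) → a ≤W b
equal-length-prefix []      []      c d _ _ = inj₁ refl
equal-length-prefix (x ∷ a) (y ∷ b) c d _ (this x<y) = inj₂ (this x<y)
equal-length-prefix (x ∷ a) (y ∷ b) c d |a|≡|b| (next refl q)
  with equal-length-prefix a b c d (ℕP.suc-injective |a|≡|b|) q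
... | inj₁ refl = inj₁ refl
... | inj₂ a<b  = inj₂ (next refl a<b)

≤⇒<++ : {a b : Word n} → a ≢ [] → a ≤W b → a <W (b ++ a)
≤⇒<++ {a = a} a≢[] (inj₁ refl) = prefix< a a≢[]
≤⇒<++ {a = a} {b} a≢[] (inj₂ a<b) with prefix-or-strong a<b
... | inj₂ strong = subst (_<W (b ++ a)) (++-identityʳ a) (strong [] a)
... | inj₁ (t , _ , refl) =
  subst (a <W_) (sym (++-assoc a t a)) (prefix< a (λ e → a≢[] (++-conicalʳ t a e)))

split++ : (a b c d : Word n) → a ++ b ≡ c ++ d →
          (Σ (Word n) λ e → c ≡ a ++ e × b ≡ e ++ d) ⊎
          (Σ (Word n) λ e → a ≡ c ++ e × d ≡ e ++ b)
split++ []      b c       d eq = inj₁ (c , refl , eq)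
split++ (x ∷ a) b []      d eq = inj₂ (x ∷ a , refl , sym eq)
split++ (x ∷ a) b (y ∷ c) d eq with ∷-injective eq
... | refl , eq′ with split++ a b c d eq′
...   | inj₁ (e , refl , b≡) = inj₁ (e , refl , b≡)
...   | inj₂ (e , refl , d≡) = inj₂ (e , refl , d≡)

≢-proper-suffix : (a w : Word n) → a ≢ [] → w ≢ a ++ w
≢-proper-suffix []      w a≢[] _ = a≢[] refl
≢-proper-suffix (x ∷ a) w _    e =
  ℕP.m≢1+n+m (length w) (trans (cong length e) (cong suc (length-++ a)))

length>0 : {x : Word n} → x ≢ [] → 0 < length x
length>0 {x = []}    x≢[] = ⊥-elim (x≢[] refl)
length>0 {x = _ ∷ _} _    = s≤s z≤n

length>0⇒≢[] : {x : Word n} → 0 < length x → x ≢ []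
length>0⇒≢[] 0<0 refl = ℕP.<-irrefl refl 0<0

length-++≥2 : {x y : Word n} → x ≢ [] → y ≢ [] → 2 ≤ length (x ++ y)
length-++≥2 {x = x} x≢[] y≢[] =
  subst (2 ≤_) (sym (length-++ x)) (ℕP.+-mono-≤ (length>0 x≢[]) (length>0 y≢[]))

-- Working characterization of Lyndon words: nonempty, and strictly smaller
-- than each proper nonempty suffix.  Equivalent to IsLyndon (below).
Lyndon : Word n → Set
Lyndon w = w ≢ [] × (∀ x y → w ≡ x ++ y → x ≢ [] → y ≢ [] → w <W y)

lyndon-letter : (x : Letter n) → Lyndon (x ∷ [])
lyndon-letter x = (λ ()) , no-split
  where
  no-split : ∀ a b → x ∷ [] ≡ a ++ b → a ≢ [] → b ≢ [] → (x ∷ []) <W b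
  no-split []          b _  a≢[] _    = ⊥-elim (a≢[] refl)
  no-split (_ ∷ [])    [] _ _    b≢[] = ⊥-elim (b≢[] refl)
  no-split (_ ∷ _ ∷ _) b  ()

lyndon-++< : {u v : Word n} → Lyndon u → Lyndon v → u <W v → (u ++ v) <W v
lyndon-++< {u = u} {v} (u≢[] , _) (_ , v<suffix) u<v with prefix-or-strong u<v
... | inj₂ strong = subst ((u ++ v) <W_) (++-identityʳ v) (strong v [])
... | inj₁ (t , t≢[] , refl) = ++-monoˡ-<W u (v<suffix u t refl u≢[] t≢[])

lyndon-++ : {u v : Word n} → Lyndon u → Lyndon v → u <W v → Lyndon (u ++ v)
lyndon-++ {u = u} {v} lu@(u≢[] , u<suffix) lv@(_ , v<suffix) u<v =
  (λ e → u≢[] (++-conicalˡ u v e)) , uv<suffix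
  where
  uv<v = lyndon-++< lu lv u<v
  uv<suffix : ∀ x y → u ++ v ≡ x ++ y → x ≢ [] → y ≢ [] → (u ++ v) <W y
  uv<suffix x y eq x≢[] y≢[] with split++ u v x y eq
  ... | inj₁ ([]    , _ , refl) = uv<v
  ... | inj₁ (e ∷ f , _ , refl) = <W-trans uv<v (v<suffix (e ∷ f) y refl (λ ()) y≢[])
  ... | inj₂ ([]    , _ , refl) = uv<v
  ... | inj₂ (e ∷ f , refl , refl) =
    short-strong (u<suffix x (e ∷ f) refl x≢[] (λ ())) (length-++-≤ʳ (e ∷ f) {x}) v v

-- Merging two consecutive factors of an increasing sequence keeps it
-- increasing: l₁ < l₂ < l₃ with l₃ Lyndon implies l₁ l₂ < l₃.
++-below : {l₁ l₂ l₃ : Word n} → l₁ ≢ [] → Lyndon l₃ → l₁ <W l₂ → l₂ <W l₃ → (l₁ ++ l₂) <W l₃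
++-below {l₁ = l₁} {l₂} {l₃} l₁≢[] (_ , l₃<suffix) l₁<l₂ l₂<l₃ with prefix-or-strong (<W-trans l₁<l₂ l₂<l₃)
... | inj₂ strong = subst ((l₁ ++ l₂) <W_) (++-identityʳ l₃) (strong l₂ [])
... | inj₁ (t , t≢[] , refl) = ++-monoˡ-<W l₁ (<W-trans l₂<l₃ (l₃<suffix l₁ t refl l₁≢[] t≢[]))

pow : ℕ → Word n → Word n
pow r v = concat (replicate r v)

pow-+ : (a b : ℕ) (v : Word n) → pow (a ℕ.+ b) v ≡ pow a v ++ pow b v
pow-+ zero    b v = refl
pow-+ (suc a) b v = trans (cong (v ++_) (pow-+ a b v)) (sym (++-assoc v (pow a v) (pow b v)))

pow-1 : (v : Word n) → pow 1 v ≡ v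
pow-1 = ++-identityʳ

pow-[] : (r : ℕ) → pow {n} r [] ≡ []
pow-[] zero    = refl
pow-[] (suc r) = pow-[] r

-- Commuting words are powers of a common word.  The recursion is on a
-- bound k for |x| + |y| (the Euclidean algorithm on the lengths).
common-root : (k : ℕ) (x y : Word n) → length x ℕ.+ length y ≤ k → x ++ y ≡ y ++ x →
              Σ (Word n) λ z → Σ ℕ λ a → Σ ℕ λ b → x ≡ pow a z × y ≡ pow b z
common-root k       []          y           _ _ = y , 0 , 1 , refl , sym (pow-1 y)
common-root k       x@(_ ∷ _)   []          _ _ = x , 1 , 0 , sym (pow-1 x) , refl
common-root zero    (_ ∷ _)     (_ ∷ _)     () _
common-root (suc k) x@(_ ∷ x′)  y@(_ ∷ y′)  bound eq with split++ x y y x eq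
... | inj₁ (e , y≡xe , y≡ex) with common-root k x e |x|+|e|≤k (trans (sym y≡xe) y≡ex)
  where
  |y|≤k : length y ≤ k
  |y|≤k = ℕP.≤-trans (ℕP.m≤n+m (length y) (length x′)) (ℕ.s≤s⁻¹ bound)
  |x|+|e|≤k : length x ℕ.+ length e ≤ k
  |x|+|e|≤k = subst (_≤ k) (trans (cong length y≡xe) (length-++ x)) |y|≤k
...   | z , a , b , x≡ , e≡ =
  z , a , a ℕ.+ b , x≡ , trans y≡xe (trans (cong₂ _++_ x≡ e≡) (sym (pow-+ a b z)))
common-root (suc k) x@(_ ∷ x′) y@(_ ∷ y′) bound eq | inj₂ (e , x≡ye , x≡ey)
  with common-root k e y |e|+|y|≤k (trans (sym x≡ey) x≡ye)
  where
  |x|≤k : length x ≤ k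
  |x|≤k = ℕP.≤-trans (ℕP.m≤m+n (length x) (length y′))
                     (ℕ.s≤s⁻¹ (subst (_≤ suc k) (ℕP.+-suc (length x) (length y′)) bound))
  |e|+|y|≤k : length e ℕ.+ length y ≤ k
  |e|+|y|≤k = subst (_≤ k) (trans (cong length x≡ey) (length-++ e)) |x|≤k
...   | z , a , b , e≡ , y≡ =
  z , b ℕ.+ a , b , trans x≡ye (trans (cong₂ _++_ y≡ e≡) (sym (pow-+ b a z))) , y≡

commuting⇒power : (x y : Word n) → x ≢ [] → y ≢ [] → x ++ y ≡ y ++ x → IsPower (x ++ y)
commuting⇒power x y x≢[] y≢[] eq with common-root _ x y ℕP.≤-refl eq
... | z , a , b , x≡ , y≡ =
  z , a ℕ.+ b , ℕP.+-mono-≤ (exponent≥1 a x≡ x≢[]) (exponent≥1 b y≡ y≢[]) ,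
  trans (cong₂ _++_ x≡ y≡) (sym (pow-+ a b z))
  where
  exponent≥1 : ∀ {w} r → w ≡ pow r z → w ≢ [] → 1 ≤ r
  exponent≥1 zero    refl w≢[] = ⊥-elim (w≢[] refl)
  exponent≥1 (suc r) _    _    = s≤s z≤n

rotate-++ : (x y : Word n) → rotate (length x) (x ++ y) ≡ y ++ x
rotate-++ x y = cong₂ _++_ (drop-++ x) (take-++ x)
  where
  drop-++ : (x : Word _) → drop (length x) (x ++ y) ≡ y
  drop-++ []      = refl
  drop-++ (_ ∷ x) = drop-++ x
  take-++ : (x : Word _) → take (length x) (x ++ y) ≡ x
  take-++ []      = refl
  take-++ (a ∷ x) = cong (a ∷_) (take-++ x)

-- Write w = x y; then w < y x since w is not a power.  If y < w,
-- then either strongly (so y x < w, impossible) or w = y q, and then q < x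
-- while comparing w with its rotation q y forces x ≤ q.
IsLyndon⇒Lyndon : {w : Word n} → IsLyndon w → Lyndon w
IsLyndon⇒Lyndon {w = w} (w≢[] , ¬power , w<rotation) = w≢[] , w<suffix
  where
  w<yx : ∀ x y → w ≡ x ++ y → x ≢ [] → y ≢ [] → w <W (y ++ x)
  w<yx x y refl x≢[] y≢[] =
    subst ((x ++ y) <W_) (rotate-++ x y)
      (w<rotation (length x) (length>0 x≢[])
        (subst (length x <_) (sym (length-++ x)) (ℕP.m<m+n (length x) (length>0 y≢[])))
        (λ e → ¬power (commuting⇒power x y x≢[] y≢[] (trans (sym e) (rotate-++ x y)))))
  w<suffix : ∀ x y → w ≡ x ++ y → x ≢ [] → y ≢ [] → w <W y
  w<suffix x y refl x≢[] y≢[] with <W-cmp (x ++ y) y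
  ... | tri< w<y _ _ = w<y
  ... | tri≈ _ w≡y _ = ⊥-elim (≢-proper-suffix x y x≢[] (sym w≡y))
  ... | tri> _ _ y<w with prefix-or-strong y<w
  ...   | inj₂ strong =
    ⊥-elim (<W-asym (w<yx x y refl x≢[] y≢[]) (subst ((y ++ x) <W_) (++-identityʳ (x ++ y)) (strong x [])))
  ...   | inj₁ (q , q≢[] , w≡yq) with equal-length-prefix x q y y |x|≡|q| (w<yx y q w≡yq y≢[] q≢[])
    where
    |x|≡|q| : length x ≡ length q
    |x|≡|q| = ℕP.+-cancelʳ-≡ (length y) (length x) (length q)
      (trans (sym (length-++ x)) (trans (cong length w≡yq) (trans (length-++ y) (ℕP.+-comm (length y) (length q)))))
  ...     | x≤q = ⊥-elim (<W-irrefl (<≤W-trans q<x x≤q))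
    where
    q<x : q <W x
    q<x = ++-cancelˡ-<W y (subst (_<W (y ++ x)) w≡yq (w<yx x y refl x≢[] y≢[]))

-- Conversely, a word smaller than its proper suffixes is a Lyndon word: a
-- proper power v^(r+2) would be both larger than its suffix v^(r+1) and
-- smaller than it as a prefix, and a rotation y x of w = x y is larger than
-- w because w < y strongly.
Lyndon⇒IsLyndon : {w : Word n} → Lyndon w → IsLyndon w
Lyndon⇒IsLyndon {w = w} (w≢[] , w<suffix) = w≢[] , ¬power , w<rotation
  where
  ¬power : ¬ IsPower w
  ¬power (_ , suc zero , s≤s () , _)
  ¬power (v , suc (suc r) , _ , w≡) with v
  ... | [] = w≢[] (trans w≡ (pow-[] (suc (suc r))))
  ... | v@(_ ∷ _) = <W-asym (w<suffix v (pow (suc r) v) w≡ (λ ()) (λ ())) v^[r+1]<w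
    where
    v^[r+1]<w : pow (suc r) v <W w
    v^[r+1]<w = subst (pow (suc r) v <W_)
      (sym (trans w≡ (trans (cong (λ k → pow k v) (ℕP.+-comm 1 (suc r))) (pow-+ (suc r) 1 v))))
      (prefix< (pow (suc r) v) (λ ()))
  w<rotation : ∀ k → 1 ≤ k → k < length w → rotate k w ≢ w → w <W rotate k w
  w<rotation k 1≤k k<|w| _ = subst (_<W rotate k w) (++-identityʳ w) (short-strong w<y |y|≤|w| [] x)
    where
    x = take k w
    y = drop k w
    x≢[] : x ≢ []
    x≢[] = length>0⇒≢[] (subst (0 <_) (sym (trans (length-take k w) (ℕP.m≤n⇒m⊓n≡m (ℕP.<⇒≤ k<|w|)))) 1≤k)
    y≢[] : y ≢ []
    y≢[] = length>0⇒≢[] (subst (0 <_) (sym (length-drop k w)) (ℕP.m<n⇒0<n∸m k<|w|))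
    w<y : w <W y
    w<y = w<suffix x y (sym (take++drop≡id k w)) x≢[] y≢[]
    |y|≤|w| : length y ≤ length w
    |y|≤|w| = subst (_≤ length w) (sym (length-drop k w)) (ℕP.m∸n≤m (length w) k)

≤-suffix⇒< : {t v : Word n} → t ≢ [] → v ≤W (t ++ v) → v <W (t ++ v)
≤-suffix⇒< {t = t} {v} t≢[] (inj₁ v≡tv) = ⊥-elim (≢-proper-suffix t v t≢[] v≡tv)
≤-suffix⇒< _ (inj₂ v<tv) = v<tv

-- Minimal suffixes and the standard factorization of a Lyndon word
-- w = u v, where v is the smallest proper suffix of w.

MinimalSuffix : Word n → Word n → Word n → Set
MinimalSuffix w p s = w ≡ p ++ s × s ≢ [] × (∀ a y → w ≡ a ++ y → y ≢ [] → s ≤W y)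

minSuffix : Letter n → Word n → Word n × Word n
minSuffix x []       = [] , x ∷ []
minSuffix x (y ∷ ys) =
  if does ((x ∷ y ∷ ys) <W? proj₂ (minSuffix y ys))
  then [] , x ∷ y ∷ ys
  else x ∷ proj₁ (minSuffix y ys) , proj₂ (minSuffix y ys)

minSuffix-minimal : (x : Letter n) (xs : Word n) →
  MinimalSuffix (x ∷ xs) (proj₁ (minSuffix x xs)) (proj₂ (minSuffix x xs))
minSuffix-minimal x [] = refl , (λ ()) , minimal
  where
  minimal : ∀ a y → x ∷ [] ≡ a ++ y → y ≢ [] → (x ∷ []) ≤W y
  minimal []          y  refl _    = inj₁ refl
  minimal (_ ∷ [])    [] _    y≢[] = ⊥-elim (y≢[] refl)
  minimal (_ ∷ _ ∷ _) _  ()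
minSuffix-minimal x (y ∷ ys) with minSuffix-minimal y ys | (x ∷ y ∷ ys) <W? proj₂ (minSuffix y ys)
... | (_ , _ , s-minimal) | yes w<s = refl , (λ ()) , minimal
  where
  minimal : ∀ a z → x ∷ y ∷ ys ≡ a ++ z → z ≢ [] → (x ∷ y ∷ ys) ≤W z
  minimal []      z refl _    = inj₁ refl
  minimal (_ ∷ a) z eq   z≢[] = inj₂ (<≤W-trans w<s (s-minimal a z (∷-injectiveʳ eq) z≢[]))
... | (ys≡ , s≢[] , s-minimal) | no w≮s = cong (x ∷_) ys≡ , s≢[] , minimal
  where
  minimal : ∀ a z → x ∷ y ∷ ys ≡ a ++ z → z ≢ [] → proj₂ (minSuffix y ys) ≤W z
  minimal []      z refl _    = ≮W⇒≥ w≮s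
  minimal (_ ∷ a) z eq   z≢[] = s-minimal a z (∷-injectiveʳ eq) z≢[]

Standard : Word n → Word n → Word n → Set
Standard w u v =
  w ≡ u ++ v × u ≢ [] × v ≢ [] × (∀ x y → w ≡ x ++ y → x ≢ [] → y ≢ [] → v ≤W y)

-- The standard factorization, computed from the minimal suffix of the tail
-- (a dummy value for words of length < 2).
standard : Word n → Word n × Word n
standard (a ∷ b ∷ ys) = a ∷ proj₁ (minSuffix b ys) , proj₂ (minSuffix b ys)
standard _            = [] , []

standard-spec : (w : Word n) → 2 ≤ length w →
                Standard w (proj₁ (standard w)) (proj₂ (standard w))
standard-spec (_ ∷ []) (s≤s ())
standard-spec (a ∷ b ∷ ys) _ with minSuffix-minimal b ys
... | (ys≡ , s≢[] , s-minimal) = cong (a ∷_) ys≡ , (λ ()) , s≢[] , minimal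
  where
  minimal : ∀ x y → a ∷ b ∷ ys ≡ x ++ y → x ≢ [] → y ≢ [] → proj₂ (minSuffix b ys) ≤W y
  minimal []      y _  x≢[] _    = ⊥-elim (x≢[] refl)
  minimal (_ ∷ x) y eq _    y≢[] = s-minimal x y (∷-injectiveʳ eq) y≢[]

standard-unique : {w u v u′ v′ : Word n} → Standard w u v → Standard w u′ v′ → u ≡ u′ × v ≡ v′
standard-unique {u = u} {v} {u′} {v′} (w≡uv , u≢[] , v≢[] , v-min) (w≡uv′ , u′≢[] , v′≢[] , v′-min) =
  ++-cancelʳ v u u′ (trans (sym w≡uv) (trans w≡uv′ (cong (u′ ++_) (sym v≡v′)))) , v≡v′
  where
  v≡v′ : v ≡ v′
  v≡v′ with v-min u′ v′ w≡uv′ u′≢[] v′≢[] | v′-min u v w≡uv u≢[] v≢[]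
  ... | inj₁ v≡v′ | _         = v≡v′
  ... | inj₂ _    | inj₁ v′≡v = sym v′≡v
  ... | inj₂ v<v′ | inj₂ v′<v = ⊥-elim (<W-asym v<v′ v′<v)

standard-right-lyndon : {w u v : Word n} → Standard w u v → Lyndon v
standard-right-lyndon {u = u} (w≡uv , u≢[] , v≢[] , v-min) = v≢[] , v<suffix
  where
  v<suffix : ∀ x y → _ ≡ x ++ y → x ≢ [] → y ≢ [] → _ <W y
  v<suffix x y refl x≢[] y≢[] with v-min (u ++ x) y (trans w≡uv (sym (++-assoc u x y)))
                                         (λ e → u≢[] (++-conicalˡ u x e)) y≢[]
  ... | inj₁ xy≡y = ⊥-elim (≢-proper-suffix x y x≢[] (sym xy≡y))
  ... | inj₂ xy<y = xy<y

-- The left standard factor of a Lyndon word is a Lyndon word: for u = x y,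
-- if y < u then either strongly, giving y v < u v = w although w < y v, or
-- u = y t, giving t v < v (cancel y in w < y v) although v ≤ t v.
standard-left-lyndon : {w u v : Word n} → Lyndon w → Standard w u v → Lyndon u
standard-left-lyndon {v = v} (_ , w<suffix) (w≡uv , u≢[] , _ , v-min) = u≢[] , u<suffix
  where
  u<suffix : ∀ x y → _ ≡ x ++ y → x ≢ [] → y ≢ [] → _ <W y
  u<suffix x y refl x≢[] y≢[] with <W-cmp (x ++ y) y
  ... | tri< u<y _ _ = u<y
  ... | tri≈ _ u≡y _ = ⊥-elim (≢-proper-suffix x y x≢[] (sym u≡y))
  ... | tri> _ _ y<u with prefix-or-strong y<u
  ...   | inj₂ strong = ⊥-elim (<W-asym w<yv (subst ((y ++ v) <W_) (sym w≡uv) (strong v v)))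
    where
    yv≢[] = λ e → y≢[] (++-conicalˡ y v e)
    w<yv : _ <W (y ++ v)
    w<yv = w<suffix x (y ++ v) (trans w≡uv (++-assoc x y v)) x≢[] yv≢[]
  ...   | inj₁ (t , t≢[] , u≡yt) = ⊥-elim (<W-asym tv<v v<tv)
    where
    yv≢[] = λ e → y≢[] (++-conicalˡ y v e)
    w≡ytv : _ ≡ y ++ (t ++ v)
    w≡ytv = trans w≡uv (trans (cong (_++ v) u≡yt) (++-assoc y t v))
    tv<v : (t ++ v) <W v
    tv<v = ++-cancelˡ-<W y (subst (_<W (y ++ v)) w≡ytv
             (w<suffix x (y ++ v) (trans w≡uv (++-assoc x y v)) x≢[] yv≢[]))
    v<tv : v <W (t ++ v)
    v<tv = ≤-suffix⇒< t≢[] (v-min y (t ++ v) w≡ytv y≢[] (λ e → t≢[] (++-conicalˡ t v e)))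

standard-left<right : {w u v : Word n} → Lyndon w → Standard w u v → u <W v
standard-left<right {u = u} (_ , w<suffix) (w≡uv , u≢[] , v≢[] , _) =
  <W-trans (subst (u <W_) (sym w≡uv) (prefix< u v≢[])) (w<suffix u _ w≡uv u≢[] v≢[])

standard-nested : {w u v u₁ u₂ : Word n} → Standard w u v → Standard u u₁ u₂ → ¬ (u₂ <W v)
standard-nested {v = v} {u₁} {u₂} std@(w≡uv , _ , v≢[] , v-min) std′@(u≡u₁u₂ , u₁≢[] , u₂≢[] , _) u₂<v =
  <W-irrefl (<≤W-trans u₂v<v v≤u₂v)
  where
  u₂v<v : (u₂ ++ v) <W v
  u₂v<v = lyndon-++< (standard-right-lyndon std′) (standard-right-lyndon std) u₂<v
  v≤u₂v : v ≤W (u₂ ++ v)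
  v≤u₂v = v-min u₁ (u₂ ++ v) (trans w≡uv (trans (cong (_++ v) u≡u₁u₂) (++-assoc u₁ u₂ v)))
                u₁≢[] (λ e → u₂≢[] (++-conicalˡ u₂ v e))

-- (l₁ , l₂) is the standard factorization of l₁ l₂ when l₂ is Lyndon and
-- no standard right factor of l₁ is smaller than l₂: a proper suffix y of l₁ l₂
-- either is a suffix of l₂ (so l₂ ≤ y), or y = e l₂ with e a proper suffix
-- of l₁, which lies above the right standard factor of l₁, hence above l₂.
standard-of-++ : {l₁ l₂ : Word n} → l₁ ≢ [] → Lyndon l₂ →
                 (∀ u v → Standard l₁ u v → ¬ (v <W l₂)) → Standard (l₁ ++ l₂) l₁ l₂
standard-of-++ {l₁ = l₁} {l₂} l₁≢[] (l₂≢[] , l₂<suffix) l₁-right≥l₂ = refl , l₁≢[] , l₂≢[] , l₂-min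
  where
  l₂-min : ∀ x y → l₁ ++ l₂ ≡ x ++ y → x ≢ [] → y ≢ [] → l₂ ≤W y
  l₂-min x y eq x≢[] y≢[] with split++ l₁ l₂ x y eq
  ... | inj₁ ([]    , _ , refl) = inj₁ refl
  ... | inj₁ (e ∷ f , _ , refl) = inj₂ (l₂<suffix (e ∷ f) y refl (λ ()) y≢[])
  ... | inj₂ ([]    , _ , refl) = inj₁ refl
  ... | inj₂ (e ∷ f , refl , refl) with standard-spec (x ++ e ∷ f) (length-++≥2 x≢[] (λ ()))
  ...   | std@(_ , _ , _ , v-min) =
    inj₂ (≤⇒<++ l₂≢[] (≤W-trans (≮W⇒≥ (l₁-right≥l₂ _ _ std)) (v-min x (e ∷ f) refl x≢[] (λ ()))))

-- The sign-reversing involution on increasing sequences of Lyndon words: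
-- split the first factor at its standard factorization when its right
-- factor stays below the second factor, and otherwise merge the first two.

Increasing : List (Word n) → Set
Increasing F = Linked _<W_ F × All Lyndon F

_<Head_ : Word n → List (Word n) → Set
v <Head []      = ⊤
v <Head (l ∷ _) = v <W l

_<Head?_ : (v : Word n) (F : List (Word n)) → Dec (v <Head F)
v <Head? []      = yes tt
v <Head? (l ∷ _) = v <W? l

<Head⇒Linked : {v l : Word n} {F : List (Word n)} → v <Head F → Linked _<W_ (l ∷ F) → Linked _<W_ (v ∷ F)
<Head⇒Linked {F = []}    _   _          = [-]
<Head⇒Linked {F = _ ∷ _} v<l (_ ∷ inc)  = v<l ∷ inc

Linked⇒<Head : {v : Word n} {F : List (Word n)} → Linked _<W_ (v ∷ F) → v <Head F
Linked⇒<Head {F = []}    _           = tt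
Linked⇒<Head {F = _ ∷ _} (v<l ∷ _)   = v<l

merge-linked : {l₁ l₂ : Word n} {F : List (Word n)} → l₁ ≢ [] → l₁ <W l₂ →
               Linked _<W_ (l₂ ∷ F) → All Lyndon F → Linked _<W_ ((l₁ ++ l₂) ∷ F)
merge-linked {F = []}    _    _     _             _          = [-]
merge-linked {F = _ ∷ _} l₁≢[] l₁<l₂ (l₂<l₃ ∷ inc) (lyn₃ ∷ _) = ++-below l₁≢[] lyn₃ l₁<l₂ l₂<l₃ ∷ inc

SplitsFirst : Word n → List (Word n) → Set
SplitsFirst l F = 2 ≤ length l × proj₂ (standard l) <Head F

splitsFirst? : (l : Word n) (F : List (Word n)) → Dec (SplitsFirst l F)
splitsFirst? l F = (2 ℕ.≤? length l) ×-dec (proj₂ (standard l) <Head? F)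

merge : Word n → List (Word n) → List (Word n)
merge l₁ []       = l₁ ∷ []
merge l₁ (l₂ ∷ F) = (l₁ ++ l₂) ∷ F

ι : List (Word n) → List (Word n)
ι []      = []
ι (l ∷ F) = if does (splitsFirst? l F)
            then proj₁ (standard l) ∷ proj₂ (standard l) ∷ F
            else merge l F

ι-split : (l : Word n) (F : List (Word n)) → SplitsFirst l F →
          ι (l ∷ F) ≡ proj₁ (standard l) ∷ proj₂ (standard l) ∷ F
ι-split l F split rewrite dec-true (splitsFirst? l F) split = refl

ι-merge : (l : Word n) (F : List (Word n)) → ¬ SplitsFirst l F → ι (l ∷ F) ≡ merge l F
ι-merge l F ¬split rewrite dec-false (splitsFirst? l F) ¬split = refl

record InvolutionAt (F : List (Word n)) : Set where
  field
    increasing : Increasing (ι F)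
    concat-ι   : concat (ι F) ≡ concat F
    ι-ι        : ι (ι F) ≡ F
    length-ι   : length (ι F) ≡ suc (length F) ⊎ length F ≡ suc (length (ι F))

involutionAt : {F G : List (Word n)} → ι F ≡ G → Increasing G → concat G ≡ concat F → ι G ≡ F →
               length G ≡ suc (length F) ⊎ length F ≡ suc (length G) → InvolutionAt F
involutionAt refl inc cat inv len = record { increasing = inc ; concat-ι = cat ; ι-ι = inv ; length-ι = len }

-- Splitting l = u v: u < v are Lyndon, v is below the rest, and u cannot be
-- split again since its right standard factor is not below v.
involution-split : (l : Word n) (F : List (Word n)) → Increasing (l ∷ F) → SplitsFirst l F →
                   InvolutionAt (l ∷ F)
involution-split l F (linked , lyn-l ∷ lyn-F) split@(2≤|l| , v<F) =
  involutionAt (ι-split l F split) increasing concat-uv ι-uv (inj₁ refl)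
  where
  u = proj₁ (standard l)
  v = proj₂ (standard l)
  std = standard-spec l 2≤|l|
  increasing : Increasing (u ∷ v ∷ F)
  increasing = standard-left<right lyn-l std ∷ <Head⇒Linked v<F linked
             , standard-left-lyndon lyn-l std ∷ standard-right-lyndon std ∷ lyn-F
  concat-uv : u ++ (v ++ concat F) ≡ l ++ concat F
  concat-uv = trans (sym (++-assoc u v (concat F))) (cong (_++ concat F) (sym (proj₁ std)))
  ι-uv : ι (u ∷ v ∷ F) ≡ l ∷ F
  ι-uv = trans (ι-merge u (v ∷ F) λ (2≤|u| , v′<v) → standard-nested std (standard-spec u 2≤|u|) v′<v)
               (cong (_∷ F) (sym (proj₁ std)))

-- Merging l₁ < l₂ to l₁ l₂: its standard factorization is (l₁ , l₂) because
-- l₁ could not be split, and l₂ is below the rest; so ι splits it back.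
involution-merge : (l : Word n) (F : List (Word n)) → Increasing (l ∷ F) → ¬ SplitsFirst l F →
                   2 ≤ length (concat (l ∷ F)) → InvolutionAt (l ∷ F)
involution-merge l [] _ ¬split 2≤|l| =
  ⊥-elim (¬split (subst (2 ≤_) (cong length (++-identityʳ l)) 2≤|l| , tt))
involution-merge l₁ (l₂ ∷ F) (l₁<l₂ ∷ linked , lyn₁ ∷ lyn₂ ∷ lyn-F) ¬split _ =
  involutionAt (ι-merge l₁ (l₂ ∷ F) ¬split) increasing (++-assoc l₁ l₂ (concat F)) ι-l₁l₂ (inj₂ refl)
  where
  l₁≢[] = proj₁ lyn₁
  increasing : Increasing ((l₁ ++ l₂) ∷ F)
  increasing = merge-linked l₁≢[] l₁<l₂ linked lyn-F , lyndon-++ lyn₁ lyn₂ l₁<l₂ ∷ lyn-F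
  l₁-unsplittable : ∀ u v → Standard l₁ u v → ¬ (v <W l₂)
  l₁-unsplittable u v std@(l₁≡uv , u≢[] , v≢[] , _) v<l₂ =
    ¬split (2≤|l₁| , subst (_<W l₂) (proj₂ (standard-unique std (standard-spec l₁ 2≤|l₁|))) v<l₂)
    where
    2≤|l₁| = subst (λ w → 2 ≤ length w) (sym l₁≡uv) (length-++≥2 u≢[] v≢[])
  std : Standard (l₁ ++ l₂) l₁ l₂
  std = standard-of-++ l₁≢[] lyn₂ l₁-unsplittable
  2≤|l₁l₂| = length-++≥2 l₁≢[] (proj₁ lyn₂)
  same = standard-unique (standard-spec (l₁ ++ l₂) 2≤|l₁l₂|) std
  ι-l₁l₂ : ι ((l₁ ++ l₂) ∷ F) ≡ l₁ ∷ l₂ ∷ F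
  ι-l₁l₂ = trans (ι-split (l₁ ++ l₂) F (2≤|l₁l₂| , l₂<F))
                 (cong₂ (λ u v → u ∷ v ∷ F) (proj₁ same) (proj₂ same))
    where
    l₂<F : proj₂ (standard (l₁ ++ l₂)) <Head F
    l₂<F = subst (_<Head F) (sym (proj₂ same)) (Linked⇒<Head linked)

involution : (F : List (Word n)) → Increasing F → 2 ≤ length (concat F) → InvolutionAt F
involution [] _ ()
involution (l ∷ F) inc 2≤|F| with splitsFirst? l F
... | yes split = involution-split l F inc split
... | no ¬split = involution-merge l F inc ¬split 2≤|F|

ChainLyndonUpTo : ℕ → List (Word n) → Set
ChainLyndonUpTo N ws =
  ∀ w → (w ∈ ws → IsLyndon w × IsChain w × length w ≤ N) ×
        (IsLyndon w × IsChain w × length w ≤ N → w ∈ ws)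

chain-nonempty : {N : ℕ} {ws : List (Word n)} → ChainLyndonUpTo N ws → All (λ w → IsChain w × w ≢ []) ws
chain-nonempty enum = All.tabulate λ w∈ → let (lyn , chain , _) = proj₁ (enum _) w∈ in chain , proj₁ lyn

chain-++ : (x y : Word n) → IsChain (x ++ y) → IsChain x × IsChain y
chain-++ []          y chain             = [] , chain
chain-++ (a ∷ [])    [] _                = [-] , []
chain-++ (a ∷ [])    (b ∷ y) (_ ∷ chain) = [-] , chain
chain-++ (a ∷ b ∷ x) y (link ∷ chain)    = map₁ (link ∷_) (chain-++ (b ∷ x) y chain)

chain-factors : (N : ℕ) (F : List (Word n)) → IsChain (concat F) → length (concat F) ≤ N →
                All (λ l → IsChain l × length l ≤ N) F
chain-factors N []      _     _       = []
chain-factors N (l ∷ F) chain |lF|≤N with chain-++ l (concat F) chain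
... | chain-l , chain-F =
  (chain-l , ℕP.≤-trans (length-++-≤ˡ l) |lF|≤N) ∷
  chain-factors N F chain-F (ℕP.≤-trans (length-++-≤ʳ (concat F) {l}) |lF|≤N)

-- Factorizations of a word into an increasing sequence of words drawn from
-- a fixed increasing list ws; they index the terms of the coefficient of
-- the word in the product of the factors (1 - w).

strip : Word n → Word n → Maybe (Word n)
strip []      u       = just u
strip (_ ∷ _) []      = nothing
strip (x ∷ w) (y ∷ u) = if does (x ≟L y) then strip w u else nothing

strip-just : (w u : Word n) {r : Word n} → strip w u ≡ just r → u ≡ w ++ r
strip-just []      u       refl = refl
strip-just (x ∷ w) (y ∷ u) eq with x ≟L y
... | yes refl = cong (x ∷_) (strip-just w u eq)

strip-++ : (w r : Word n) → strip w (w ++ r) ≡ just r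
strip-++ []      r = refl
strip-++ (x ∷ w) r rewrite dec-true (x ≟L x) refl = strip-++ w r

factorizations : List (Word n) → Word n → List (List (Word n))
factorizations []       []      = [] ∷ []
factorizations []       (_ ∷ _) = []
factorizations (w ∷ ws) u       =
  factorizations ws u ++ maybe′ (λ r → map (w ∷_) (factorizations ws r)) [] (strip w u)

IsFactorization : List (Word n) → Word n → List (Word n) → Set
IsFactorization ws u s = Linked _<W_ s × All (_∈ ws) s × concat s ≡ u

below-tail : {w : Word n} {ws : List (Word n)} → Linked _<W_ (w ∷ ws) → All (w <W_) ws
below-tail {ws = []}    _             = []
below-tail {ws = _ ∷ _} (w<v ∷ inc)   = Linked⇒All <W-trans w<v inc

above-head : {w : Word n} {ws s : List (Word n)} → All (w <W_) s → All (_∈ (w ∷ ws)) s → All (_∈ ws) s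
above-head above in-w∷ws = All.zipWith drop-w (above , in-w∷ws)
  where
  drop-w : ∀ {w ws y} → w <W y × y ∈ (w ∷ ws) → y ∈ ws
  drop-w (w<w , here refl) = ⊥-elim (<W-irrefl w<w)
  drop-w (_   , there y∈)  = y∈

cons-linked : {w : Word n} {ws s : List (Word n)} → All (w <W_) ws → All (_∈ ws) s →
              Linked _<W_ s → Linked _<W_ (w ∷ s)
cons-linked below []         _      = [-]
cons-linked below (v∈ ∷ _)   linked = All.lookup below v∈ ∷ linked

factorizations-sound : (ws : List (Word n)) (u : Word n) → Linked _<W_ ws →
                       ∀ {s} → s ∈ factorizations ws u → IsFactorization ws u s
factorizations-sound []       []      _ (here refl) = [] , [] , refl
factorizations-sound (w ∷ ws) u       inc s∈ with ∈-++⁻ (factorizations ws u) s∈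
... | inj₁ s∈′ with factorizations-sound ws u (Linked.tail inc) s∈′
...   | linked , all∈ , concat≡ = linked , All.map there all∈ , concat≡
factorizations-sound (w ∷ ws) u inc s∈ | inj₂ s∈′ with strip w u in eq
... | just r with ∈-map⁻ (w ∷_) s∈′
...   | s , s∈″ , refl with factorizations-sound ws r (Linked.tail inc) s∈″
...     | linked , all∈ , concat≡ =
  cons-linked (below-tail inc) all∈ linked , here refl ∷ All.map there all∈ ,
  trans (cong (w ++_) concat≡) (sym (strip-just w u eq))

factorizations-complete : (ws : List (Word n)) (u : Word n) → Linked _<W_ ws →
                          ∀ {s} → IsFactorization ws u s → s ∈ factorizations ws u
factorizations-complete []       _ _ {[]}    (_ , _ , refl)  = here refl
factorizations-complete []       _ _ {_ ∷ _} (_ , () ∷ _ , _)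
factorizations-complete (w ∷ ws) u inc {[]} (_ , _ , u≡[]) =
  ∈-++⁺ˡ (factorizations-complete ws u (Linked.tail inc) ([] , [] , u≡[]))
factorizations-complete (w ∷ ws) u inc {w ∷ s} (linked , here refl ∷ all∈ , refl) =
  ∈-++⁺ʳ (factorizations ws u) (subst (λ m → (w ∷ s) ∈ maybe′ _ [] m) (sym (strip-++ w (concat s)))
    (∈-map⁺ (w ∷_) (factorizations-complete ws (concat s) (Linked.tail inc)
      (Linked.tail linked , above-head (below-tail linked) all∈ , refl))))
factorizations-complete (w ∷ ws) u inc {v ∷ s} (linked , there v∈ ∷ all∈ , concat≡) =
  ∈-++⁺ˡ (factorizations-complete ws u (Linked.tail inc)
    (linked , v∈ ∷ above-head (All.map (<W-trans w<v) (below-tail linked)) all∈ , concat≡))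
  where
  w<v = All.lookup (below-tail inc) v∈

factorizations-unique : (ws : List (Word n)) (u : Word n) → Linked _<W_ ws →
                        Unique (factorizations ws u)
factorizations-unique []       []      _ = [] AllPairs.∷ AllPairs.[]
factorizations-unique []       (_ ∷ _) _ = AllPairs.[]
factorizations-unique (w ∷ ws) u inc with strip w u
... | nothing = subst Unique (sym (++-identityʳ _)) (factorizations-unique ws u (Linked.tail inc))
... | just r  = Unique.++⁺ (factorizations-unique ws u (Linked.tail inc))
                           (Unique.map⁺ ∷-injectiveʳ (factorizations-unique ws r (Linked.tail inc)))
                           disjoint
  where
  disjoint : ∀ {s} → ¬ (s ∈ factorizations ws u × s ∈ map (w ∷_) (factorizations ws r))
  disjoint (s∈ , s∈′) with ∈-map⁻ (w ∷_) s∈′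
  ... | _ , _ , refl with factorizations-sound ws u (Linked.tail inc) s∈
  ...   | _ , w∈ws ∷ _ , _ = <W-irrefl (All.lookup (below-tail inc) w∈ws)

module _ {X : Set} where

  unique-remove : (L₁ : List X) {z : X} {L₂ : List X} → Unique (L₁ ++ z ∷ L₂) →
                  z ∉ (L₁ ++ L₂) × Unique (L₁ ++ L₂)
  unique-remove L₁ {z} {L₂} u with PermS.Unique-resp-↭ (≡-setoid X) (↭⇒↭ₛ (shift z L₁ L₂)) u
  ... | u″@(_ AllPairs.∷ u′) = Unique[x∷xs]⇒x∉xs u″ , u′

  ∈-insert⁺ : (L₁ : List X) {z y : X} {L₂ : List X} → y ∈ (L₁ ++ L₂) → y ∈ (L₁ ++ z ∷ L₂)
  ∈-insert⁺ L₁ {z} {_} {L₂} y∈ = ∈-resp-↭ (↭-sym (shift z L₁ L₂)) (there y∈)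

  length-insert : (L₁ : List X) {z : X} {L₂ : List X} → length (L₁ ++ z ∷ L₂) ≡ suc (length (L₁ ++ L₂))
  length-insert []       = refl
  length-insert (_ ∷ L₁) = cong suc (length-insert L₁)

  ∈-insert⁻ : (L₁ : List X) {z y : X} {L₂ : List X} → y ∈ (L₁ ++ z ∷ L₂) → y ≡ z ⊎ y ∈ (L₁ ++ L₂)
  ∈-insert⁻ L₁ {z} {_} {L₂} y∈ with ∈-resp-↭ (shift z L₁ L₂) y∈
  ... | here y≡z = inj₁ y≡z
  ... | there y∈′ = inj₂ y∈′

module _ {c ℓ} (R : Ring c ℓ) where

  open Ring R using (Carrier; _≈_; _+_; _*_; -_; 0#; 1#; setoid;
                     +-cong; +-congˡ; +-congʳ; +-assoc; +-comm; +-identityˡ; +-identityʳ;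
                     -‿cong; -‿inverseʳ; *-congˡ; *-congʳ; *-assoc; *-identityˡ; *-identityʳ;
                     zeroˡ; zeroʳ; distribˡ)
                 renaming (refl to ≈-refl; sym to ≈-sym; trans to ≈-trans; reflexive to ≈-reflexive)
  open import Algebra.Properties.Ring R using (-0#≈0#; -‿involutive; -‿+-comm; -‿distribˡ-*; -‿distribʳ-*)
  open import Relation.Binary.Reasoning.Setoid setoid
  import Algebra.Properties.CommutativeMonoid.Sum (Ring.+-commutativeMonoid R) as Sum

  sumL : {X : Set} → (X → Carrier) → List X → Carrier
  sumL f []      = 0#
  sumL f (x ∷ L) = f x + sumL f L

  sumL-++ : {X : Set} (f : X → Carrier) (L₁ L₂ : List X) → sumL f (L₁ ++ L₂) ≈ sumL f L₁ + sumL f L₂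
  sumL-++ f []       L₂ = ≈-sym (+-identityˡ _)
  sumL-++ f (x ∷ L₁) L₂ = ≈-trans (+-congˡ (sumL-++ f L₁ L₂)) (≈-sym (+-assoc _ _ _))

  sumL-insert : {X : Set} (f : X → Carrier) (L₁ : List X) (z : X) (L₂ : List X) →
                sumL f (L₁ ++ z ∷ L₂) ≈ f z + sumL f (L₁ ++ L₂)
  sumL-insert f L₁ z L₂ = begin
    sumL f (L₁ ++ z ∷ L₂)           ≈⟨ sumL-++ f L₁ (z ∷ L₂) ⟩
    sumL f L₁ + (f z + sumL f L₂)   ≈⟨ ≈-sym (+-assoc _ _ _) ⟩
    (sumL f L₁ + f z) + sumL f L₂   ≈⟨ +-congʳ (+-comm _ _) ⟩
    (f z + sumL f L₁) + sumL f L₂   ≈⟨ +-assoc _ _ _ ⟩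
    f z + (sumL f L₁ + sumL f L₂)   ≈⟨ +-congˡ (≈-sym (sumL-++ f L₁ L₂)) ⟩
    f z + sumL f (L₁ ++ L₂)         ∎

  SignReversingPairing : {X : Set} → (X → Carrier) → (X → X) → List X → Set ℓ
  SignReversingPairing f ι L =
    ∀ {x} → x ∈ L → ι x ∈ L × ι x ≢ x × ι (ι x) ≡ x × f (ι x) ≈ - f x

  -- Remove an element together with its partner and recurse; k bounds the length.
  pairing-sum-zero : {X : Set} (f : X → Carrier) (ι : X → X) (k : ℕ) (L : List X) →
                     length L ≤ k → Unique L → SignReversingPairing f ι L → sumL f L ≈ 0#
  pairing-sum-zero f ι k       []      _ _ _ = ≈-refl
  pairing-sum-zero f ι (suc k) (x ∷ L) (s≤s |L|≤k) unique pairing with pairing (here refl)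
  ... | here ιx≡x , ιx≢x , _ , _ = ⊥-elim (ιx≢x ιx≡x)
  ... | there ιx∈L , ιx≢x , ιιx≡x , f-ιx with ∈-∃++ ιx∈L
  ...   | L₁ , L₂ , refl with unique-remove L₁ (AllPairs.tail unique)
  ...     | ιx∉L₁L₂ , unique′ = begin
    f x + sumL f (L₁ ++ ι x ∷ L₂)       ≈⟨ +-congˡ (sumL-insert f L₁ (ι x) L₂) ⟩
    f x + (f (ι x) + sumL f (L₁ ++ L₂)) ≈⟨ ≈-sym (+-assoc _ _ _) ⟩
    (f x + f (ι x)) + sumL f (L₁ ++ L₂) ≈⟨ +-cong (≈-trans (+-congˡ f-ιx) (-‿inverseʳ _)) rest-zero ⟩
    0# + 0#                              ≈⟨ +-identityˡ _ ⟩
    0#                                   ∎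
    where
    x∉L = Unique[x∷xs]⇒x∉xs unique
    pairing′ : SignReversingPairing f ι (L₁ ++ L₂)
    pairing′ {y} y∈ with pairing (there (∈-insert⁺ L₁ y∈))
    ... | here ιy≡x , _ , ιιy≡y , _ =
      ⊥-elim (ιx∉L₁L₂ (subst (_∈ (L₁ ++ L₂)) (trans (sym ιιy≡y) (cong ι ιy≡x)) y∈))
    ... | there ιy∈ , ιy≢y , ιιy≡y , f-ιy with ∈-insert⁻ L₁ ιy∈
    ...   | inj₂ ιy∈′ = ιy∈′ , ιy≢y , ιιy≡y , f-ιy
    ...   | inj₁ ιy≡ιx = ⊥-elim (x∉L (∈-insert⁺ L₁
              (subst (_∈ (L₁ ++ L₂)) (trans (sym ιιy≡y) (trans (cong ι ιy≡ιx) ιιx≡x)) y∈)))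
    rest-zero : sumL f (L₁ ++ L₂) ≈ 0#
    rest-zero = pairing-sum-zero f ι k (L₁ ++ L₂)
      (ℕP.≤-trans (ℕP.n≤1+n _) (subst (_≤ k) (length-insert L₁) |L|≤k)) unique′ pairing′

  -- Noncommutative series over the letters, as coefficient functions, and
  -- the ordered product of the factors (1 - w).

  FreeSeries : ℕ → Set c
  FreeSeries n = Word n → Carrier

  _·F_ : Word n → FreeSeries n → FreeSeries n
  (w ·F f) u = maybe′ f 0# (strip w u)

  -- (1 - w₁)(1 - w₂)⋯(1 - w_k) for ws = w₁ ⋯ w_k
  factorProd : List (Word n) → FreeSeries n
  factorProd []       []      = 1#
  factorProd []       (_ ∷ _) = 0#
  factorProd (w ∷ ws) u       = factorProd ws u + - (w ·F factorProd ws) u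

  oneMinusLetters : FreeSeries n
  oneMinusLetters []          = 1#
  oneMinusLetters (_ ∷ [])    = - 1#
  oneMinusLetters (_ ∷ _ ∷ _) = 0#

  alternating : ℕ → Carrier
  alternating zero    = 1#
  alternating (suc k) = - alternating k

  sign : List (Word n) → Carrier
  sign s = alternating (length s)

  sumL-sign-cons : (w : Word n) (L : List (List (Word n))) →
                   sumL sign (map (w ∷_) L) ≈ - sumL sign L
  sumL-sign-cons w []      = ≈-sym -0#≈0#
  sumL-sign-cons w (s ∷ L) = ≈-trans (+-congˡ (sumL-sign-cons w L)) (-‿+-comm _ _)

  factorProd≈signed-sum : (ws : List (Word n)) (u : Word n) →
                          factorProd ws u ≈ sumL sign (factorizations ws u)
  factorProd≈signed-sum []       []      = ≈-sym (+-identityʳ _)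
  factorProd≈signed-sum []       (_ ∷ _) = ≈-refl
  factorProd≈signed-sum (w ∷ ws) u with strip w u
  ... | nothing = begin
    factorProd ws u + - 0#                           ≈⟨ +-cong (factorProd≈signed-sum ws u) -0#≈0# ⟩
    sumL sign (factorizations ws u) + 0#             ≈⟨ ≈-sym (sumL-++ sign (factorizations ws u) []) ⟩
    sumL sign (factorizations ws u ++ [])            ∎
  ... | just r = begin
    factorProd ws u + - factorProd ws r
      ≈⟨ +-cong (factorProd≈signed-sum ws u) (-‿cong (factorProd≈signed-sum ws r)) ⟩
    sumL sign (factorizations ws u) + - sumL sign (factorizations ws r)
      ≈⟨ +-congˡ (≈-sym (sumL-sign-cons w (factorizations ws r))) ⟩
    sumL sign (factorizations ws u) + sumL sign (map (w ∷_) (factorizations ws r))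
      ≈⟨ ≈-sym (sumL-++ sign (factorizations ws u) _) ⟩
    sumL sign (factorizations ws u ++ map (w ∷_) (factorizations ws r)) ∎

  -- For a chain word u with 2 ≤ |u| ≤ N, the involution ι pairs off the
  -- factorizations of u into chain Lyndon words, with opposite signs.
  factorProd-long : (N : ℕ) (ws : List (Word n)) → Linked _<W_ ws → ChainLyndonUpTo N ws →
                    (u : Word n) → IsChain u → 2 ≤ length u → length u ≤ N → factorProd ws u ≈ 0#
  factorProd-long N ws inc enum u chain 2≤|u| |u|≤N =
    ≈-trans (factorProd≈signed-sum ws u)
            (pairing-sum-zero sign ι _ (factorizations ws u) ℕP.≤-refl (factorizations-unique ws u inc) pairing)
    where
    pairing : SignReversingPairing sign ι (factorizations ws u)
    pairing {s} s∈ = ιs∈ , ιs≢s , InvolutionAt.ι-ι inv , sign-ι (InvolutionAt.length-ι inv)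
      where
      open InvolutionAt
      sound = factorizations-sound ws u inc s∈
      concat≡ = proj₂ (proj₂ sound)
      lyndon-s : All Lyndon s
      lyndon-s = All.map (λ l∈ → IsLyndon⇒Lyndon (proj₁ (proj₁ (enum _) l∈))) (proj₁ (proj₂ sound))
      inv = involution s (proj₁ sound , lyndon-s) (subst (λ v → 2 ≤ length v) (sym concat≡) 2≤|u|)
      concat-ιs : concat (ι s) ≡ u
      concat-ιs = trans (concat-ι inv) concat≡
      factors : All (λ l → IsChain l × length l ≤ N) (ι s)
      factors = chain-factors N (ι s) (subst IsChain (sym concat-ιs) chain)
                              (subst (λ v → length v ≤ N) (sym concat-ιs) |u|≤N)
      ιs∈ : ι s ∈ factorizations ws u
      ιs∈ = factorizations-complete ws u inc
        ( proj₁ (increasing inv)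
        , All.zipWith (λ (lyn , ok) → proj₂ (enum _) (Lyndon⇒IsLyndon lyn , ok)) (proj₂ (increasing inv) , factors)
        , concat-ιs)
      ιs≢s : ι s ≢ s
      ιs≢s ιs≡s with length-ι inv
      ... | inj₁ eq = ℕP.1+n≢n (trans (sym eq) (cong length ιs≡s))
      ... | inj₂ eq = ℕP.1+n≢n (trans (sym eq) (cong length (sym ιs≡s)))
      sign-ι : length (ι s) ≡ suc (length s) ⊎ length s ≡ suc (length (ι s)) → sign (ι s) ≈ - sign s
      sign-ι (inj₁ eq) rewrite eq = ≈-refl
      sign-ι (inj₂ eq) rewrite eq = ≈-sym (-‿involutive _)

  -- The empty word only has the empty factorization.
  factorProd-[] : (ws : List (Word n)) → All (_≢ []) ws → factorProd ws [] ≈ 1#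
  factorProd-[] []            _              = ≈-refl
  factorProd-[] ([] ∷ ws)     ([]≢[] ∷ _)    = ⊥-elim ([]≢[] refl)
  factorProd-[] ((_ ∷ _) ∷ ws) (_ ∷ nonempty) =
    ≈-trans (+-cong (factorProd-[] ws nonempty) -0#≈0#) (+-identityʳ _)

  strip-letter : (w : Word n) (x : Letter n) → w ≢ [] → w ≢ x ∷ [] → strip w (x ∷ []) ≡ nothing
  strip-letter []          x w≢[] _ = ⊥-elim (w≢[] refl)
  strip-letter (y ∷ w) x _ w≢x with y ≟L x | w
  ... | no _     | _      = refl
  ... | yes refl | []     = ⊥-elim (w≢x refl)
  ... | yes refl | _ ∷ _  = refl

  -- A one-letter word x factors only as itself, with sign -1, if x ∈ ws.
  factorProd-letter-absent : (ws : List (Word n)) (x : Letter n) → All (_≢ []) ws →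
                             x ∷ [] ∉ ws → factorProd ws (x ∷ []) ≈ 0#
  factorProd-letter-absent []       x _                 _    = ≈-refl
  factorProd-letter-absent (w ∷ ws) x (w≢[] ∷ nonempty) x∉ rewrite strip-letter w x w≢[] (λ e → x∉ (here (sym e))) =
    ≈-trans (+-cong (factorProd-letter-absent ws x nonempty (λ x∈ → x∉ (there x∈))) -0#≈0#) (+-identityʳ _)

  factorProd-letter : (ws : List (Word n)) (x : Letter n) → Linked _<W_ ws → All (_≢ []) ws →
                      x ∷ [] ∈ ws → factorProd ws (x ∷ []) ≈ - 1#
  factorProd-letter (w ∷ ws) x inc (_ ∷ nonempty) (here refl) rewrite strip-++ (x ∷ []) [] =
    ≈-trans (+-cong (factorProd-letter-absent ws x nonempty (λ x∈ → <W-irrefl (All.lookup (below-tail inc) x∈)))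
                    (-‿cong (factorProd-[] ws nonempty)))
            (+-identityˡ _)
  factorProd-letter (w ∷ ws) x inc (w≢[] ∷ nonempty) (there x∈)
    rewrite strip-letter w x w≢[] (λ e → <W-irrefl (subst (_<W (x ∷ [])) e (All.lookup (below-tail inc) x∈))) =
    ≈-trans (+-cong (factorProd-letter ws x (Linked.tail inc) nonempty x∈) -0#≈0#) (+-identityʳ _)

  lyndon-product : (N : ℕ) (ws : List (Word n)) → Linked _<W_ ws → ChainLyndonUpTo N ws →
                   (u : Word n) → IsChain u → length u ≤ N → factorProd ws u ≈ oneMinusLetters u
  lyndon-product N ws inc enum []            _     _     = factorProd-[] ws (All.map proj₂ (chain-nonempty enum))
  lyndon-product N ws inc enum (x ∷ [])      _     |x|≤N =
    factorProd-letter ws x inc (All.map proj₂ (chain-nonempty enum))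
      (proj₂ (enum _) (Lyndon⇒IsLyndon (lyndon-letter x) , [-] , |x|≤N))
  lyndon-product N ws inc enum u@(_ ∷ _ ∷ _) chain |u|≤N = factorProd-long N ws inc enum u chain (s≤s (s≤s z≤n)) |u|≤N

  open MatSeries R

  sumFin≡sum : ∀ m (f : Fin m → Carrier) → sumFin m f ≡ Sum.sum f
  sumFin≡sum zero    f = refl
  sumFin≡sum (suc m) f = cong (f Fin.zero +_) (sumFin≡sum m (λ k → f (Fin.suc k)))

  sumFin-cong : ∀ m {f g : Fin m → Carrier} → (∀ k → f k ≈ g k) → sumFin m f ≈ sumFin m g
  sumFin-cong zero    f≈g = ≈-refl
  sumFin-cong (suc m) f≈g = +-cong (f≈g Fin.zero) (sumFin-cong m (λ k → f≈g (Fin.suc k)))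

  sumFin-zero : ∀ m {f : Fin m → Carrier} → (∀ k → f k ≈ 0#) → sumFin m f ≈ 0#
  sumFin-zero m {f} f≈0 = ≈-trans (sumFin-cong m f≈0) (≈-trans (≈-reflexive (sumFin≡sum m _)) (Sum.sum-replicate-zero m))

  sumFin-+ : ∀ m (f g : Fin m → Carrier) → sumFin m (λ k → f k + g k) ≈ sumFin m f + sumFin m g
  sumFin-+ m f g rewrite sumFin≡sum m (λ k → f k + g k) | sumFin≡sum m f | sumFin≡sum m g = Sum.∑-distrib-+ f g

  sumFin-neg : ∀ m (f : Fin m → Carrier) → sumFin m (λ k → - f k) ≈ - sumFin m f
  sumFin-neg zero    f = ≈-sym -0#≈0#
  sumFin-neg (suc m) f = ≈-trans (+-congˡ (sumFin-neg m _)) (-‿+-comm _ _)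

  sumFin-single : ∀ m (q : Fin m) (f : Fin m → Carrier) → (∀ k → k ≢ q → f k ≈ 0#) → sumFin m f ≈ f q
  sumFin-single (suc m) Fin.zero f vanish =
    ≈-trans (+-congˡ (sumFin-zero m (λ k → vanish (Fin.suc k) (λ ())))) (+-identityʳ _)
  sumFin-single (suc m) (Fin.suc q) f vanish =
    ≈-trans (+-cong (vanish Fin.zero (λ ())) (sumFin-single m q (λ k → f (Fin.suc k))
                      (λ k k≢q → vanish (Fin.suc k) (λ e → k≢q (FinP.suc-injective e)))))
            (+-identityˡ _)

  𝐈-*M : ∀ {n} (Q : Mat n) i j → (𝐈 *M Q) i j ≈ Q i j
  𝐈-*M {n} Q i j = ≈-trans (sumFin-single n i _ off-diagonal) diagonal
    where
    off-diagonal : ∀ l → l ≢ i → (𝐈 i l * Q l j) ≈ 0#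
    off-diagonal l l≢i with i Fin.≟ l
    ... | yes i≡l = ⊥-elim (l≢i (sym i≡l))
    ... | no _    = zeroˡ _
    diagonal : 𝐈 i i * Q i j ≈ Q i j
    diagonal rewrite dec-true (i Fin.≟ i) refl = *-identityˡ _

  𝟎-*M : ∀ {n} (Q : Mat n) i j → (𝟎 *M Q) i j ≈ 0#
  𝟎-*M {n} Q i j = sumFin-zero n (λ _ → zeroˡ _)

  -M-*M : ∀ {n} (X Q : Mat n) i j → ((-M X) *M Q) i j ≈ - (X *M Q) i j
  -M-*M {n} X Q i j = ≈-trans (sumFin-cong n (λ _ → ≈-sym (-‿distribˡ-* _ _))) (sumFin-neg n _)

  𝐄-*M : ∀ {n} (x : Carrier) (p q : Fin n) (Q : Mat n) i j →
         ((x ·M 𝐄 p q) *M Q) i j ≈ (if does (i Fin.≟ p) then x * Q q j else 0#)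
  𝐄-*M {n} x p q Q i j with i Fin.≟ p
  ... | no _  = sumFin-zero n (λ _ → ≈-trans (*-congʳ (zeroʳ x)) (zeroˡ _))
  ... | yes _ = ≈-trans (sumFin-single n q _ off-column) column
    where
    -- with i = p, the entry (i , l) of E_{pq} is [l = q]
    off-column : ∀ l → l ≢ q → (x * (if does (l Fin.≟ q) then 1# else 0#)) * Q l j ≈ 0#
    off-column l l≢q with l Fin.≟ q
    ... | yes l≡q = ⊥-elim (l≢q l≡q)
    ... | no _    = ≈-trans (*-congʳ (zeroʳ x)) (zeroˡ _)
    column : (x * (if does (q Fin.≟ q) then 1# else 0#)) * Q q j ≈ x * Q q j
    column rewrite dec-true (q Fin.≟ q) refl = *-congʳ (*-identityʳ x)

  I-MtPow-on : ∀ {n} (X : Mat n) r → I-MtPow X (suc r) (suc r) ≡ -M X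
  I-MtPow-on X r rewrite dec-true (suc r ℕ.≟ suc r) refl = refl

  I-MtPow-off : ∀ {n} (X : Mat n) r t → suc t ≢ r → I-MtPow X r (suc t) ≡ 𝟎
  I-MtPow-off X r t t+1≢r rewrite dec-false (suc t ℕ.≟ r) t+1≢r = refl

  factor-*S : ∀ {n} (X : Mat n) r (P : Series n) m i j →
              (I-MtPow X r *S P) m i j ≈
              P m i j + sumFin m (λ k → (I-MtPow X r (suc (toℕ k)) *M P (m ∸ suc (toℕ k))) i j)
  factor-*S X r P m i j = +-congʳ (𝐈-*M (P m) i j)

  factor-*S-low : ∀ {n} (X : Mat n) r (P : Series n) m i j → m < r → (I-MtPow X r *S P) m i j ≈ P m i j
  factor-*S-low X r P m i j m<r =
    ≈-trans (factor-*S X r P m i j) (≈-trans (+-congˡ (sumFin-zero m vanish)) (+-identityʳ _))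
    where
    vanish : ∀ k → (I-MtPow X r (suc (toℕ k)) *M P (m ∸ suc (toℕ k))) i j ≈ 0#
    vanish k rewrite I-MtPow-off X r (toℕ k) (λ e → ℕP.<-irrefl e (ℕP.≤-<-trans (FinP.toℕ<n k) m<r))
      = 𝟎-*M (P (m ∸ suc (toℕ k))) i j

  factor-*S-high : ∀ {n} (X : Mat n) r (P : Series n) m′ i j →
                   (I-MtPow X (suc r) *S P) (suc r ℕ.+ m′) i j ≈ P (suc r ℕ.+ m′) i j + - (X *M P m′) i j
  factor-*S-high X r P m′ i j = ≈-trans (factor-*S X (suc r) P m i j) (+-congˡ (≈-trans pick (term-r)))
    where
    m = suc r ℕ.+ m′
    term : ℕ → Carrier
    term t = (I-MtPow X (suc r) (suc t) *M P (m ∸ suc t)) i j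
    r<m : r < m
    r<m = s≤s (ℕP.m≤m+n r m′)
    pick : sumFin m (λ k → term (toℕ k)) ≈ term r
    pick = ≈-trans (sumFin-single m (Fin.fromℕ< r<m) _ vanish)
                   (≈-reflexive (cong term (FinP.toℕ-fromℕ< r<m)))
      where
      vanish : ∀ k → k ≢ Fin.fromℕ< r<m → term (toℕ k) ≈ 0#
      vanish k k≢r rewrite I-MtPow-off X (suc r) (toℕ k)
        (λ e → k≢r (FinP.toℕ-injective (trans (ℕP.suc-injective e) (sym (FinP.toℕ-fromℕ< r<m)))))
        = 𝟎-*M (P (m ∸ suc (toℕ k))) i j
    term-r : term r ≈ - (X *M P m′) i j
    term-r rewrite I-MtPow-on X r | ℕP.m+n∸m≡n (suc r) m′ = -M-*M X (P m′) i j

  -- Evaluation of a free series at a matrix a: the letter (i , k) becomes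
  -- a_{ik} E_{ik} t.  The (i , j) entry of the degree-m coefficient is the sum,
  -- over the chain words u = (i,k₁)(k₁,k₂)⋯(k_{m-1},j), of f(u) a_{ik₁}⋯a_{k_{m-1}j}.
  evaluate : ∀ {n} → Mat n → FreeSeries n → Series n
  evaluate     a f zero    i j = if does (i Fin.≟ j) then f [] else 0#
  evaluate {n} a f (suc m) i j = sumFin n (λ k → a i k * evaluate a (λ u → f ((i , k) ∷ u)) m k j)

  StartsAt : ∀ {n} → Fin n → Word n → Set
  StartsAt i []      = ⊤
  StartsAt i (x ∷ _) = proj₁ x ≡ i

  module _ {n : ℕ} (a : Mat n) where

    evaluate-cong : ∀ m i j {f g : FreeSeries n} →
                    (∀ u → IsChain u → StartsAt i u → length u ≡ m → f u ≈ g u) →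
                    evaluate a f m i j ≈ evaluate a g m i j
    evaluate-cong zero i j f≈g with does (i Fin.≟ j)
    ... | true  = f≈g [] [] tt refl
    ... | false = ≈-refl
    evaluate-cong (suc m) i j f≈g =
      sumFin-cong n (λ k → *-congˡ (evaluate-cong m k j (λ u chain start |u|≡m →
        f≈g ((i , k) ∷ u) (cons-chain u chain start) refl (cong suc |u|≡m))))
      where
      cons-chain : ∀ {k} (u : Word n) → IsChain u → StartsAt k u → IsChain ((i , k) ∷ u)
      cons-chain []      _     _     = [-]
      cons-chain (_ ∷ _) chain start = sym start ∷ chain

    evaluate-0 : ∀ m i j → evaluate a (λ _ → 0#) m i j ≈ 0#
    evaluate-0 zero    i j with does (i Fin.≟ j)
    ... | true  = ≈-refl
    ... | false = ≈-refl
    evaluate-0 (suc m) i j = sumFin-zero n (λ k → ≈-trans (*-congˡ (evaluate-0 m k j)) (zeroʳ _))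

    evaluate-linear : ∀ m i j (f g : FreeSeries n) →
                      evaluate a (λ u → f u + - g u) m i j ≈ evaluate a f m i j + - evaluate a g m i j
    evaluate-linear zero i j f g with does (i Fin.≟ j)
    ... | true  = ≈-refl
    ... | false = ≈-sym (≈-trans (+-congˡ -0#≈0#) (+-identityʳ _))
    evaluate-linear (suc m) i j f g = begin
      sumFin n (λ k → a i k * evaluate a (λ u → f′ k u + - g′ k u) m k j)
        ≈⟨ sumFin-cong n (λ k → ≈-trans (*-congˡ (evaluate-linear m k j (f′ k) (g′ k)))
                                  (≈-trans (distribˡ _ _ _) (+-congˡ (≈-sym (-‿distribʳ-* _ _))))) ⟩
      sumFin n (λ k → a i k * evaluate a (f′ k) m k j + - (a i k * evaluate a (g′ k) m k j))
        ≈⟨ ≈-trans (sumFin-+ n _ _) (+-congˡ (sumFin-neg n _)) ⟩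
      evaluate a f (suc m) i j + - evaluate a g (suc m) i j ∎
      where
      f′ g′ : Fin n → FreeSeries n
      f′ k u = f ((i , k) ∷ u)
      g′ k u = g ((i , k) ∷ u)

    ·F-cons-≡ : (x y : Letter n) (w u : Word n) (f : FreeSeries n) → x ≡ y → ((x ∷ w) ·F f) (y ∷ u) ≡ (w ·F f) u
    ·F-cons-≡ x _ w u f refl rewrite dec-true (x ≟L x) refl = refl

    ·F-cons-≢ : (x y : Letter n) (w u : Word n) (f : FreeSeries n) → x ≢ y → ((x ∷ w) ·F f) (y ∷ u) ≡ 0#
    ·F-cons-≢ x y w u f x≢y rewrite dec-false (x ≟L y) x≢y = refl

    evaluate-·F-low : (w : Word n) (f : FreeSeries n) → w ≢ [] → ∀ m i j → m < length w →
                      evaluate a (w ·F f) m i j ≈ 0#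
    evaluate-·F-low []      f w≢[] _ _ _ _ = ⊥-elim (w≢[] refl)
    evaluate-·F-low (x ∷ w) f _ zero i j _ with does (i Fin.≟ j)
    ... | true  = ≈-refl
    ... | false = ≈-refl
    evaluate-·F-low (x ∷ w) f _ (suc m) i j (s≤s m<|w|) = sumFin-zero n term
      where
      term : ∀ k → a i k * evaluate a (λ u → ((x ∷ w) ·F f) ((i , k) ∷ u)) m k j ≈ 0#
      term k = by-cases (x ≟L (i , k))
        where
        by-cases : Dec (x ≡ (i , k)) → a i k * evaluate a (λ u → ((x ∷ w) ·F f) ((i , k) ∷ u)) m k j ≈ 0#
        by-cases (yes x≡ik) = ≈-trans (*-congˡ (≈-trans
          (evaluate-cong m k j (λ u _ _ _ → ≈-reflexive (·F-cons-≡ x (i , k) w u f x≡ik)))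
          (evaluate-·F-low w f (λ { refl → ℕP.<-irrefl refl (ℕP.≤-<-trans z≤n m<|w|) }) m k j m<|w|)))
          (zeroʳ _)
        by-cases (no x≢ik) = ≈-trans (*-congˡ (≈-trans
          (evaluate-cong m k j (λ u _ _ _ → ≈-reflexive (·F-cons-≢ x (i , k) w u f x≢ik)))
          (evaluate-0 m k j)))
          (zeroʳ _)

    if-true : {p : Fin n} {X : Carrier} (d : Dec (p ≡ p)) → (if does d then X else 0#) ≈ X
    if-true (yes _)   = ≈-refl
    if-true (no p≢p)  = ⊥-elim (p≢p refl)

    evaluate-·F-high : (x : Letter n) (w : Word n) → IsChain (x ∷ w) → (f : FreeSeries n) → ∀ m i j →
      evaluate a ((x ∷ w) ·F f) (length (x ∷ w) ℕ.+ m) i j ≈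
      (if does (i Fin.≟ proj₁ x) then chainCoef a x w * evaluate a f m (lastSnd a x w) j else 0#)
    evaluate-·F-high (p , q) w chain f m i j with i Fin.≟ p
    ... | no i≢p = sumFin-zero n λ k → ≈-trans (*-congˡ (≈-trans
            (evaluate-cong (length w ℕ.+ m) k j
              (λ u _ _ _ → ≈-reflexive (·F-cons-≢ (p , q) (i , k) w u f (λ e → i≢p (sym (cong proj₁ e))))))
            (evaluate-0 (length w ℕ.+ m) k j))) (zeroʳ _)
    ... | yes refl = ≈-trans (sumFin-single n q _ off-column) (column w chain)
      where
      off-column : ∀ k → k ≢ q →
                   a i k * evaluate a (λ u → (((i , q) ∷ w) ·F f) ((i , k) ∷ u)) (length w ℕ.+ m) k j ≈ 0#
      off-column k k≢q = ≈-trans (*-congˡ (≈-trans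
        (evaluate-cong (length w ℕ.+ m) k j
          (λ u _ _ _ → ≈-reflexive (·F-cons-≢ (i , q) (i , k) w u f (λ e → k≢q (sym (cong proj₂ e))))))
        (evaluate-0 (length w ℕ.+ m) k j))) (zeroʳ _)
      -- the surviving term k = q: strip the letter (i , q) and recurse along the chain
      column : (w : Word n) → IsChain ((i , q) ∷ w) →
               a i q * evaluate a (λ u → (((i , q) ∷ w) ·F f) ((i , q) ∷ u)) (length w ℕ.+ m) q j ≈
               chainCoef a (i , q) w * evaluate a f m (lastSnd a (i , q) w) j
      column w _ with evaluate-cong (length w ℕ.+ m) q j {g = w ·F f}
                        (λ u _ _ _ → ≈-reflexive (·F-cons-≡ (i , q) (i , q) w u f refl))
      column []                [-]            | strip-first = *-congˡ strip-first
      column ((_ , r) ∷ w′) (refl ∷ chain′) | strip-first =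
        ≈-trans (*-congˡ (≈-trans strip-first (≈-trans (evaluate-·F-high (q , r) w′ chain′ f m q j)
                                                        (if-true (q Fin.≟ q)))))
                (≈-sym (*-assoc _ _ _))

    if-cong : (b : Bool) {X Y : Carrier} → X ≈ Y → (if b then X else 0#) ≈ (if b then Y else 0#)
    if-cong true  X≈Y = X≈Y
    if-cong false _   = ≈-refl

    -- Multiplying by the factor of a chain word w commutes with evaluation:
    -- below degree |w| nothing changes, and in degree |w| + m′ both sides
    -- subtract a_w times row (last column of w) of the degree-m′ coefficient.
    factor-evaluate : (x : Letter n) (w : Word n) → IsChain (x ∷ w) → (P : Series n) (f : FreeSeries n) →
                      (∀ m i j → P m i j ≈ evaluate a f m i j) → ∀ m i j →
                      (factor a (x ∷ w) *S P) m i j ≈ evaluate a (λ u → f u + - ((x ∷ w) ·F f) u) m i j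
    factor-evaluate x w chain P f P≈f m i j with m ℕ.<? length (x ∷ w)
    ... | yes m<|xw| = begin
      (I-MtPow X (length (x ∷ w)) *S P) m i j       ≈⟨ factor-*S-low X _ P m i j m<|xw| ⟩
      P m i j                                         ≈⟨ P≈f m i j ⟩
      evaluate a f m i j                              ≈⟨ ≈-sym (≈-trans (+-congˡ (≈-trans (-‿cong w·f-vanishes) -0#≈0#)) (+-identityʳ _)) ⟩
      evaluate a f m i j + - evaluate a ((x ∷ w) ·F f) m i j ≈⟨ ≈-sym (evaluate-linear m i j f ((x ∷ w) ·F f)) ⟩
      evaluate a (λ u → f u + - ((x ∷ w) ·F f) u) m i j ∎
      where
      X = chainCoef a x w ·M 𝐄 (proj₁ x) (lastSnd a x w)
      w·f-vanishes = evaluate-·F-low (x ∷ w) f (λ ()) m i j m<|xw|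
    ... | no m≮|xw| = subst (λ m → (factor a (x ∷ w) *S P) m i j ≈ evaluate a (λ u → f u + - ((x ∷ w) ·F f) u) m i j)
                            (ℕP.m+[n∸m]≡n (ℕP.≮⇒≥ m≮|xw|)) (high (m ∸ length (x ∷ w)))
      where
      X = chainCoef a x w ·M 𝐄 (proj₁ x) (lastSnd a x w)
      high : ∀ m′ → (factor a (x ∷ w) *S P) (length (x ∷ w) ℕ.+ m′) i j ≈
                    evaluate a (λ u → f u + - ((x ∷ w) ·F f) u) (length (x ∷ w) ℕ.+ m′) i j
      high m′ = begin
        (I-MtPow X (suc (length w)) *S P) M i j
          ≈⟨ factor-*S-high X (length w) P m′ i j ⟩
        P M i j + - (X *M P m′) i j
          ≈⟨ +-cong (P≈f M i j) (-‿cong (≈-trans (𝐄-*M _ _ _ (P m′) i j)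
                       (if-cong (does (i Fin.≟ proj₁ x)) (*-congˡ (P≈f m′ _ j))))) ⟩
        evaluate a f M i j + - (if does (i Fin.≟ proj₁ x) then chainCoef a x w * evaluate a f m′ (lastSnd a x w) j else 0#)
          ≈⟨ +-congˡ (-‿cong (≈-sym (evaluate-·F-high x w chain f m′ i j))) ⟩
        evaluate a f M i j + - evaluate a ((x ∷ w) ·F f) M i j
          ≈⟨ ≈-sym (evaluate-linear M i j f ((x ∷ w) ·F f)) ⟩
        evaluate a (λ u → f u + - ((x ∷ w) ·F f) u) M i j ∎
        where
        M = length (x ∷ w) ℕ.+ m′

    orderedProd≈evaluate : (ws : List (Word n)) → All (λ w → IsChain w × w ≢ []) ws → ∀ m i j →
                           orderedProd a ws m i j ≈ evaluate a (factorProd ws) m i j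
    orderedProd≈evaluate []             _ zero    i j = ≈-refl
    orderedProd≈evaluate []             _ (suc m) i j =
      ≈-sym (sumFin-zero n (λ k → ≈-trans (*-congˡ (evaluate-0 m k j)) (zeroʳ _)))
    orderedProd≈evaluate ([] ∷ ws)      ((_ , []≢[]) ∷ _) = ⊥-elim ([]≢[] refl)
    orderedProd≈evaluate ((x ∷ w) ∷ ws) ((chain , _) ∷ ok) =
      factor-evaluate x w chain (orderedProd a ws) (factorProd ws) (orderedProd≈evaluate ws ok)

    evaluate-oneMinusLetters : ∀ m i j → evaluate a oneMinusLetters m i j ≈ I-At a m i j
    evaluate-oneMinusLetters zero          i j = ≈-refl
    evaluate-oneMinusLetters (suc zero)    i j = ≈-trans (sumFin-single n j _ off-column) column
      where
      off-column : ∀ k → k ≢ j → a i k * (if does (k Fin.≟ j) then - 1# else 0#) ≈ 0#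
      off-column k k≢j with k Fin.≟ j
      ... | yes k≡j = ⊥-elim (k≢j k≡j)
      ... | no _    = zeroʳ _
      column : a i j * (if does (j Fin.≟ j) then - 1# else 0#) ≈ - a i j
      column = ≈-trans (*-congˡ (if-true (j Fin.≟ j))) (≈-trans (≈-sym (-‿distribʳ-* _ _)) (-‿cong (*-identityʳ _)))
    evaluate-oneMinusLetters (suc (suc m)) i j =
      sumFin-zero n (λ k → ≈-trans (*-congˡ (sumFin-zero n (λ l → ≈-trans (*-congˡ (evaluate-0 m l j)) (zeroʳ _))))
                                   (zeroʳ _))

  matrix-lyndon-product : ∀ {n} (A : Mat n) (m N : ℕ) → m ≤ N → (ws : List (Word n)) →
                          Linked _<W_ ws → ChainLyndonUpTo N ws → ∀ i j → orderedProd A ws m i j ≈ I-At A m i j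
  matrix-lyndon-product A m N m≤N ws inc enum i j = begin
    orderedProd A ws m i j               ≈⟨ orderedProd≈evaluate A ws (chain-nonempty enum) m i j ⟩
    evaluate A (factorProd ws) m i j     ≈⟨ evaluate-cong A m i j (λ u chain _ |u|≡m →
                                              lyndon-product N ws inc enum u chain (subst (_≤ N) (sym |u|≡m) m≤N)) ⟩
    evaluate A oneMinusLetters m i j     ≈⟨ evaluate-oneMinusLetters A m i j ⟩
    I-At A m i j                         ∎

-- Proposition 2.3, coefficientwise.
proposition2p3 : ∀ {c ℓ} (A : Ring c ℓ) (n : ℕ) → 1 ≤ n →
    (𝐀 : MatSeries.Mat A n) →
    (m N : ℕ) → m ≤ N →
    (ws : List (Word n)) → Linked _<W_ ws →
    (∀ w → (w ∈ ws → IsLyndon w × IsChain w × length w ≤ N)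
         × (IsLyndon w × IsChain w × length w ≤ N → w ∈ ws)) →
    MatSeries._≈[_]_ A (MatSeries.I-At A 𝐀) m (MatSeries.orderedProd A 𝐀 ws)
proposition2p3 A n _ 𝐀 m N m≤N ws increasing enumerates i j =
  Ring.sym A (matrix-lyndon-product A 𝐀 m N m≤N ws increasing enumerates i j)
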